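{- Let $H=(V,E)$ be a graph and let $Y$ be a minimal blocking set of $H$. Let $H'=(V\cup\{v\},E\cup\{\{v,y\}:y\in Y\})$ where $v\notin V$ is a new vertex. Then $\mathrm{OPT}(H')=\mathrm{OPT}(H)+1$, and $Y\cup\{v\}$ is a minimal blocking set of $H'$.
   Context: All graphs are finite, simple and undirected. $\mathrm{OPT}(G)$ is the minimum vertex cover size. A set $Y\subseteq V(G)$ is a blocking set of $G$ if no vertex cover of size $\mathrm{OPT}(G)$ contains $Y$; minimal if no proper subset of $Y$ is a blocking set. -}

module Defs where

open import Data.Bool using (Bool; true; false)
open import Data.Nat using (ℕ; zero; suc; _⊓_)
open import Data.Fin using (Fin; zero; suc)
open import Data.Fin.Subset using (Subset; _∈_; _⊆_; _⊂_; ∣_∣; inside; outside)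
open import Data.Fin.Subset.Properties using (_∈?_)
open import Data.Fin.Properties using (all?)
open import Data.List using (List; []; _∷_; map; _++_; foldr)
open import Data.Vec using (Vec; []; _∷_; lookup)
open import Data.Product using (Σ; _×_; _,_)
open import Data.Sum using (_⊎_)
open import Relation.Binary.PropositionalEquality using (_≡_)
open import Relation.Nullary using (¬_; Dec; yes; no)
open import Relation.Nullary.Decidable using (⌊_⌋; _⊎-dec_; _→-dec_)
open import Data.Bool.Properties using (_≟_)

record Graph (n : ℕ) : Set where
  field
    adj   : Fin n → Fin n → Bool
    sym   : ∀ i j → adj i j ≡ adj j i
    irrefl : ∀ i → adj i i ≡ false
open Graph public

IsVertexCover : ∀ {n} → Graph n → Subset n → Set
IsVertexCover G C = ∀ i j → adj G i j ≡ true → i ∈ C ⊎ j ∈ C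

isVertexCover? : ∀ {n} (G : Graph n) (C : Subset n) → Dec (IsVertexCover G C)
isVertexCover? G C =
  all? λ i → all? λ j → (adj G i j ≟ true) →-dec ((i ∈? C) ⊎-dec (j ∈? C))

allSubsets : (n : ℕ) → List (Subset n)
allSubsets zero = [] ∷ []
allSubsets (suc n) = map (inside ∷_) (allSubsets n) ++ map (outside ∷_) (allSubsets n)

-- OPT(G): minimum size of a vertex cover (the full vertex set, of size n,
-- is always a cover, so n is a valid initial value of the minimum).
OPT : ∀ {n} → Graph n → ℕ
OPT {n} G = foldr step n (allSubsets n)
  where
  step : Subset n → ℕ → ℕ
  step C m with isVertexCover? G C
  ... | yes _ = ∣ C ∣ ⊓ m
  ... | no  _ = m

IsBlockingSet : ∀ {n} → Graph n → Subset n → Set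
IsBlockingSet G Y =
  ¬ (Σ _ λ C → IsVertexCover G C × ∣ C ∣ ≡ OPT G × Y ⊆ C)

IsMinimalBlockingSet : ∀ {n} → Graph n → Subset n → Set
IsMinimalBlockingSet G Y =
  IsBlockingSet G Y × (∀ Z → Z ⊂ Y → ¬ IsBlockingSet G Z)

-- H' = H plus a new vertex v adjacent exactly to the vertices of Y.
-- The new vertex v is 'zero : Fin (suc n)'; old vertex i is 'suc i'.
extAdj : ∀ {n} → Graph n → Subset n → Fin (suc n) → Fin (suc n) → Bool
extAdj G Y zero zero = false
extAdj G Y zero (suc j) = lookup Y j
extAdj G Y (suc i) zero = lookup Y i
extAdj G Y (suc i) (suc j) = adj G i j

extAdj-sym : ∀ {n} (G : Graph n) (Y : Subset n) i j → extAdj G Y i j ≡ extAdj G Y j i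
extAdj-sym G Y zero zero = Relation.Binary.PropositionalEquality.refl
extAdj-sym G Y zero (suc j) = Relation.Binary.PropositionalEquality.refl
extAdj-sym G Y (suc i) zero = Relation.Binary.PropositionalEquality.refl
extAdj-sym G Y (suc i) (suc j) = sym G i j

extAdj-irrefl : ∀ {n} (G : Graph n) (Y : Subset n) i → extAdj G Y i i ≡ false
extAdj-irrefl G Y zero = Relation.Binary.PropositionalEquality.refl
extAdj-irrefl G Y (suc i) = irrefl G i

extend : ∀ {n} → Graph n → Subset n → Graph (suc n)
extend G Y = record { adj = extAdj G Y ; sym = extAdj-sym G Y ; irrefl = extAdj-irrefl G Y }

addNew : ∀ {n} → Subset n → Subset (suc n)
addNew Y = inside ∷ Y

module Submission where

-- 1. OPT is characterised as a minimum: it is a lower bound on the size of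
--    every vertex cover, and it is the size of some cover.  Both facts are
--    read off the fold that defines OPT.
-- 2. General facts on blocking sets of any graph G: a cover containing a
--    blocking set has size > OPT(G); a blocking set is nonempty; and if Y is
--    minimal blocking, then (not-not) some cover of size OPT(G)+1 contains Y,
--    obtained by adding y ∈ Y to an optimal cover containing Y - y.
-- 3. Covers of H' = H + v: the vertex v is adjacent exactly to Y, so a set
--    is a cover of H' iff its trace on V(H) covers H and either v is in it
--    or Y is contained in the trace.
-- 4. The theorem: OPT(H') = OPT(H)+1 (v together with an optimal cover of H
--    covers H'; a cover of H' avoiding v contains Y, hence is large); Y ∪ {v}
--    is blocking; and each proper subset Z of Y ∪ {v} is non-blocking, by
--    lifting a suitable cover of H according to whether v ∈ Z.

open import Defs hiding (sym)
open import Data.Nat using (ℕ; suc; _+_; _≤_; s≤s; z≤n)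
open import Data.Nat.Properties
  using ( ≤-refl; ≤-trans; ≤-antisym; ≤∧≢⇒<; m⊓n≤m; m⊓n≤n; ⊓-sel; suc-injective
        ; +-suc; +-comm; +-monoʳ-≤)
open import Data.Fin using (Fin; zero; suc)
open import Data.Fin.Properties using () renaming (_≟_ to _≟ᶠ_)
open import Data.Fin.Subset
  using (Subset; _⊆_; _⊂_; ∣_∣; inside; outside; ⊤; _∪_; ⁅_⁆; _-_; Nonempty)
open import Data.Fin.Subset.Properties
  using ( drop-there; drop-∷-⊆; drop-∷-⊂; s⊆s; out⊆; ∈⊤; ∣⊤∣≡n; ∣p∣≤∣x∷p∣; nonempty?
        ; x∈⁅x⁆; ∣⁅x⁆∣≡1; x∈p∪q⁺; x∈p∧x≢y⇒x∈p-y; x∈p⇒p-x⊂p; ⊆-trans)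
open import Data.Vec using ([]; _∷_; here; there)
open import Data.Vec.Properties using (lookup⇒[]=; []=⇒lookup)
open import Data.List using ([]; _∷_; foldr; map)
open import Data.List.Membership.Propositional using () renaming (_∈_ to _∈ˡ_)
open import Data.List.Membership.Propositional.Properties using (∈-map⁺; ∈-++⁺ˡ; ∈-++⁺ʳ)
open import Data.List.Relation.Unary.Any using (here; there)
open import Data.Product using (Σ; _×_; _,_; proj₁)
open import Data.Sum using (_⊎_; inj₁; inj₂; [_,_]′) renaming (map to ⊎-map)
open import Relation.Binary.PropositionalEquality using (_≡_; refl; sym; trans; cong; subst)
open import Relation.Nullary using (¬_; yes; no)
open import Relation.Nullary.Negation using (contradiction; ¬¬-map)

CoverAbove : ∀ {n} → Graph n → ℕ → Subset n → Set
CoverAbove G k Z = Σ (Subset _) λ C → IsVertexCover G C × ∣ C ∣ ≡ k × Z ⊆ C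

coverAbove-⊆ : ∀ {n} {G : Graph n} {k} {Z Z′ : Subset n} →
  Z′ ⊆ Z → CoverAbove G k Z → CoverAbove G k Z′
coverAbove-⊆ Z′⊆Z (C , cov , size , Z⊆C) = C , cov , size , ⊆-trans Z′⊆Z Z⊆C

nonBlocking-⊆ : ∀ {n} {G : Graph n} {Z Z′ : Subset n} →
  Z′ ⊆ Z → ¬ IsBlockingSet G Z → ¬ IsBlockingSet G Z′
nonBlocking-⊆ {G = G} Z′⊆Z = ¬¬-map (coverAbove-⊆ {G = G} {k = OPT G} Z′⊆Z)

∣p∪q∣≤∣p∣+∣q∣ : ∀ {n} (p q : Subset n) → ∣ p ∪ q ∣ ≤ ∣ p ∣ + ∣ q ∣
∣p∪q∣≤∣p∣+∣q∣ [] [] = z≤n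
∣p∪q∣≤∣p∣+∣q∣ (outside ∷ p) (outside ∷ q) = ∣p∪q∣≤∣p∣+∣q∣ p q
∣p∪q∣≤∣p∣+∣q∣ (outside ∷ p) (inside ∷ q) =
  subst (suc ∣ p ∪ q ∣ ≤_) (sym (+-suc ∣ p ∣ ∣ q ∣)) (s≤s (∣p∪q∣≤∣p∣+∣q∣ p q))
∣p∪q∣≤∣p∣+∣q∣ (inside ∷ p) (t ∷ q) =
  s≤s (≤-trans (∣p∪q∣≤∣p∣+∣q∣ p q) (+-monoʳ-≤ ∣ p ∣ (∣p∣≤∣x∷p∣ t q)))

∣p∪⁅x⁆∣≤1+∣p∣ : ∀ {n} (p : Subset n) (x : Fin n) → ∣ p ∪ ⁅ x ⁆ ∣ ≤ suc ∣ p ∣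
∣p∪⁅x⁆∣≤1+∣p∣ p x =
  subst (∣ p ∪ ⁅ x ⁆ ∣ ≤_) (trans (cong (∣ p ∣ +_) (∣⁅x⁆∣≡1 x)) (+-comm ∣ p ∣ 1))
    (∣p∪q∣≤∣p∣+∣q∣ p ⁅ x ⁆)

∈-allSubsets : ∀ {n} (C : Subset n) → C ∈ˡ allSubsets n
∈-allSubsets [] = here refl
∈-allSubsets (inside ∷ C) = ∈-++⁺ˡ (∈-map⁺ (inside ∷_) (∈-allSubsets C))
∈-allSubsets {suc n} (outside ∷ C) =
  ∈-++⁺ʳ (map (inside ∷_) (allSubsets n)) (∈-map⁺ (outside ∷_) (∈-allSubsets C))

module Optimum {n} (G : Graph n) where

  -- The fold defining OPT G, with its (anonymous) step function exposed.
  optAsFold : Σ (Subset n → ℕ → ℕ) λ step → OPT G ≡ foldr step n (allSubsets n)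
  optAsFold = _ , refl

  step : Subset n → ℕ → ℕ
  step = proj₁ optAsFold

  step-≤ : ∀ C m → step C m ≤ m
  step-≤ C m with isVertexCover? G C
  ... | yes _ = m⊓n≤n ∣ C ∣ m
  ... | no  _ = ≤-refl

  step-≤-cover : ∀ C m → IsVertexCover G C → step C m ≤ ∣ C ∣
  step-≤-cover C m cov with isVertexCover? G C
  ... | yes _   = m⊓n≤m ∣ C ∣ m
  ... | no ¬cov = contradiction cov ¬cov

  step-attained : ∀ C m → step C m ≡ m ⊎ (IsVertexCover G C × step C m ≡ ∣ C ∣)
  step-attained C m with isVertexCover? G C
  ... | yes cov = [ (λ eq → inj₂ (cov , eq)) , inj₁ ]′ (⊓-sel ∣ C ∣ m)
  ... | no  _   = inj₁ refl

  fold-≤-cover : ∀ m L C → C ∈ˡ L → IsVertexCover G C → foldr step m L ≤ ∣ C ∣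
  fold-≤-cover m (C ∷ L) .C (here refl) cov = step-≤-cover C _ cov
  fold-≤-cover m (C′ ∷ L) C (there C∈L) cov =
    ≤-trans (step-≤ C′ _) (fold-≤-cover m L C C∈L cov)

  fold-attained : ∀ m L → Σ (Subset n) (λ C → IsVertexCover G C × ∣ C ∣ ≡ m) →
    Σ (Subset n) λ C → IsVertexCover G C × ∣ C ∣ ≡ foldr step m L
  fold-attained m [] init = init
  fold-attained m (C′ ∷ L) init with step-attained C′ (foldr step m L)
  ... | inj₁ eq         = let (C , cov , size) = fold-attained m L init in
                          C , cov , trans size (sym eq)
  ... | inj₂ (cov , eq) = C′ , cov , sym eq

  opt-≤ : ∀ C → IsVertexCover G C → OPT G ≤ ∣ C ∣
  opt-≤ C = fold-≤-cover n (allSubsets n) C (∈-allSubsets C)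

  -- ... and is attained (the full vertex set, of size n, seeds the fold).
  opt-attained : Σ (Subset n) λ C → IsVertexCover G C × ∣ C ∣ ≡ OPT G
  opt-attained = fold-attained n (allSubsets n) (⊤ , (λ _ _ _ → inj₁ ∈⊤) , ∣⊤∣≡n n)

open Optimum using (opt-≤; opt-attained)

module Blocking {n} (G : Graph n) {Y : Subset n} (blocking : IsBlockingSet G Y) where

  opt<cover : ∀ C → IsVertexCover G C → Y ⊆ C → suc (OPT G) ≤ ∣ C ∣
  opt<cover C cov Y⊆C = ≤∧≢⇒< (opt-≤ G C cov) (λ eq → blocking (C , cov , sym eq , Y⊆C))

  -- A blocking set is nonempty: otherwise any optimal cover contains it.
  nonempty : Nonempty Y
  nonempty with nonempty? Y
  ... | yes y∈Y = y∈Y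
  ... | no empty =
    let (C , cov , size) = opt-attained G in
    contradiction (C , cov , size , λ {y} y∈Y → contradiction (y , y∈Y) empty) blocking

  addBack : ∀ y → CoverAbove G (OPT G) (Y - y) → CoverAbove G (suc (OPT G)) Y
  addBack y (C , cov , size , Y-y⊆C) = C′ , cov′ , size′ , Y⊆C′
    where
    C′ : Subset n
    C′ = C ∪ ⁅ y ⁆

    cov′ : IsVertexCover G C′
    cov′ i j e = ⊎-map (λ i∈C → x∈p∪q⁺ (inj₁ i∈C)) (λ j∈C → x∈p∪q⁺ (inj₁ j∈C)) (cov i j e)

    Y⊆C′ : Y ⊆ C′
    Y⊆C′ {z} z∈Y with z ≟ᶠ y
    ... | yes refl = x∈p∪q⁺ (inj₂ (x∈⁅x⁆ y))
    ... | no  z≢y  = x∈p∪q⁺ (inj₁ (Y-y⊆C (x∈p∧x≢y⇒x∈p-y z∈Y z≢y)))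

    size′ : ∣ C′ ∣ ≡ suc (OPT G)
    size′ = ≤-antisym (subst (λ k → ∣ C′ ∣ ≤ suc k) size (∣p∪⁅x⁆∣≤1+∣p∣ C y))
                      (opt<cover C′ cov′ Y⊆C′)

  -- If Y is minimal, some cover of size OPT G + 1 contains Y (not-not, since
  -- non-blocking only refutes the absence of an optimal cover above Y - y).
  minimal⇒coverAbove : (∀ Z → Z ⊂ Y → ¬ IsBlockingSet G Z) →
    ¬ ¬ CoverAbove G (suc (OPT G)) Y
  minimal⇒coverAbove minimal =
    let (y , y∈Y) = nonempty in
    ¬¬-map (addBack y) (minimal (Y - y) (x∈p⇒p-x⊂p y∈Y))

module Extension {n} (H : Graph n) (Y : Subset n) where

  H′ : Graph (suc n)
  H′ = extend H Y

  restrict : ∀ {b C} → IsVertexCover H′ (b ∷ C) → IsVertexCover H C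
  restrict cov i j e = ⊎-map drop-there drop-there (cov (suc i) (suc j) e)

  withNew : ∀ {C} → IsVertexCover H C → IsVertexCover H′ (inside ∷ C)
  withNew cov zero    j       _ = inj₁ here
  withNew cov (suc i) zero    _ = inj₂ here
  withNew cov (suc i) (suc j) e = ⊎-map there there (cov i j e)

  withoutNew : ∀ {C} → IsVertexCover H C → Y ⊆ C → IsVertexCover H′ (outside ∷ C)
  withoutNew cov Y⊆C zero    zero    ()
  withoutNew cov Y⊆C zero    (suc j) e = inj₂ (there (Y⊆C (lookup⇒[]= j Y e)))
  withoutNew cov Y⊆C (suc i) zero    e = inj₁ (there (Y⊆C (lookup⇒[]= i Y e)))
  withoutNew cov Y⊆C (suc i) (suc j) e = ⊎-map there there (cov i j e)

  withoutNew⁻ : ∀ {C} → IsVertexCover H′ (outside ∷ C) → Y ⊆ C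
  withoutNew⁻ cov {y} y∈Y with cov zero (suc y) ([]=⇒lookup y∈Y)
  ... | inj₁ ()
  ... | inj₂ y∈C = drop-there y∈C

  liftWithNew : ∀ {k Z} → CoverAbove H k Z → CoverAbove H′ (suc k) (inside ∷ Z)
  liftWithNew (C , cov , size , Z⊆C) = inside ∷ C , withNew cov , cong suc size , s⊆s Z⊆C

  liftWithoutNew : ∀ {k} → CoverAbove H k Y → CoverAbove H′ k (outside ∷ Y)
  liftWithoutNew (C , cov , size , Y⊆C) = outside ∷ C , withoutNew cov Y⊆C , size , s⊆s Y⊆C

  module _ (blocking : IsBlockingSet H Y) where
    open Blocking H blocking using (opt<cover; minimal⇒coverAbove)

    -- OPT(H′) = OPT(H) + 1: an optimal cover of H plus v covers H′, while an
    -- optimal cover of H′ either contains v or (avoiding v) contains Y.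
    opt-extend : OPT H′ ≡ suc (OPT H)
    opt-extend = ≤-antisym upper lower
      where
      upper : OPT H′ ≤ suc (OPT H)
      upper = let (C , cov , size) = opt-attained H in
              subst (λ k → OPT H′ ≤ suc k) size (opt-≤ H′ (inside ∷ C) (withNew cov))

      lower : suc (OPT H) ≤ OPT H′
      lower with opt-attained H′
      ... | inside  ∷ C , cov , size =
        subst (suc (OPT H) ≤_) size (s≤s (opt-≤ H C (restrict cov)))
      ... | outside ∷ C , cov , size =
        subst (suc (OPT H) ≤_) size (opt<cover C (restrict cov) (withoutNew⁻ cov))

    atOpt′ : ∀ {Z} → CoverAbove H′ (suc (OPT H)) Z → CoverAbove H′ (OPT H′) Z
    atOpt′ = subst (λ k → CoverAbove H′ k _) (sym opt-extend)

    -- Y ∪ {v} is blocking: an optimal cover of H′ containing it would restrict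
    -- to an optimal cover of H containing Y.
    extend-blocking : IsBlockingSet H′ (addNew Y)
    extend-blocking (outside ∷ C , _ , _ , Y∪v⊆C) with Y∪v⊆C here
    ... | ()
    extend-blocking (inside ∷ C , cov , size , Y∪v⊆C) =
      blocking (C , restrict cov , suc-injective (trans size opt-extend) , drop-∷-⊆ Y∪v⊆C)

    -- Proper subsets of Y ∪ {v} are non-blocking: if v ∈ Z, lift an optimal
    -- cover of H above Z ∖ {v} (a proper subset of Y) by adding v; if v ∉ Z,
    -- then Z ⊆ Y, and a cover of H of size OPT(H) + 1 above Y covers H′.
    extend-minimal : (∀ Z → Z ⊂ Y → ¬ IsBlockingSet H Z) →
      ∀ Z → Z ⊂ addNew Y → ¬ IsBlockingSet H′ Z
    extend-minimal minimal (inside ∷ Z) Z⊂Y∪v =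
      ¬¬-map (λ c → atOpt′ (liftWithNew c)) (minimal Z (drop-∷-⊂ Z⊂Y∪v))
    extend-minimal minimal (outside ∷ Z) (Z⊆Y∪v , _) =
      nonBlocking-⊆ {G = H′} (out⊆ (drop-∷-⊆ Z⊆Y∪v))
        (¬¬-map (λ c → atOpt′ (liftWithoutNew c)) (minimal⇒coverAbove minimal))

lemma22 : ∀ {n} (H : Graph n) (Y : Subset n) → IsMinimalBlockingSet H Y →
    (OPT (extend H Y) ≡ suc (OPT H)) × IsMinimalBlockingSet (extend H Y) (addNew Y)
lemma22 H Y (blocking , minimal) =
  opt-extend blocking , extend-blocking blocking , extend-minimal blocking minimal
  where open Extension H Y
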